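{- For every positive integer $n$: $\binom{12n}{3n}\equiv\binom{12n}{4n}\equiv 0 \pmod{6n-1}$; $\binom{30n}{5n}\equiv 0\pmod{(10n-1)(15n-1)}$; $\binom{60n}{6n}\equiv\binom{120n}{40n}\equiv\binom{120n}{45n}\equiv 0\pmod{30n-1}$; $\binom{330n}{88n}\equiv 0\pmod{66n-1}$. -}

module Defs where

-- Put n = t + 1 and let d be the modulus.  Each binomial coefficient of the
-- theorem is reached by walking up the diagonal C(m, k) ↦ C(m+1, k+1), which
-- is governed by the absorption identity (k+1)·C(m+1,k+1) = (m+1)·C(m,k).
-- The walk starts at C(M, j) with d ∣ M, so that d ∣ j·C(M, j); afterwards
-- every step preserves divisibility by d as long as k+1 is prime to d.
-- Coprimality of d and k+1 is certified by a Euclidean step: a relation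
-- a·(k+1) ± r = b·d with a small remainder r, plus Coprime d r, which comes
-- from the residue of d modulo r.  When k+1 may share a factor with d, the
-- same relation trades k+1 for the residue r, carried along as a multiplier
-- that the last step removes using an exact ratio (m+1)/(k+1).

module Submission where

open import Defs
open import Data.Nat using (ℕ; _*_; _∸_; _≥_)
open import Data.Nat.Divisibility using (_∣_)
open import Data.Nat.Combinatorics using (_C_)
open import Data.Product using (_×_)

open import Data.Nat using (zero; suc; _+_; z≤n; s≤s)
open import Data.Nat.Properties using (*-comm; *-assoc; *-identityˡ; *-identityʳ; *-zeroʳ; +-comm; *-suc; *-cancelˡ-≡)
open import Data.Nat.Divisibility using (divides; ∣-trans; n∣m*n; ∣m+n∣m⇒∣n; ∣m⇒∣m*n; ∣n⇒∣m*n)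
open import Data.Nat.Combinatorics using (nCk+nC[k+1]≡[n+1]C[k+1]; nC1≡n; k>n⇒nCk≡0)
open import Data.Nat.Coprimality using (Coprime; coprime?; coprime-divisor; 1-coprimeTo)
import Data.Nat.Coprimality as Coprimality
open import Data.Nat.Tactic.RingSolver using (solve; solve-∀)
open import Data.List using (_∷_; [])
open import Data.Product using (_,_)
open import Function.Base using (_∋_)
open import Relation.Binary.PropositionalEquality using (_≡_; refl; sym; trans; cong; cong₂; subst; subst₂; module ≡-Reasoning)
open import Relation.Nullary.Decidable using (from-yes)

absorption : ∀ m k → suc k * (suc m C suc k) ≡ suc m * (m C k)
absorption zero    zero    = refl
absorption zero    (suc k) = begin
    suc (suc k) * (1 C suc (suc k))  ≡⟨ cong (suc (suc k) *_) (k>n⇒nCk≡0 {1} {suc (suc k)} (s≤s (s≤s z≤n))) ⟩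
    suc (suc k) * 0                  ≡⟨ *-zeroʳ (suc (suc k)) ⟩
    1 * 0                            ≡⟨ cong (1 *_) (k>n⇒nCk≡0 {0} {suc k} (s≤s z≤n)) ⟨
    1 * (0 C suc k)                  ∎
  where open ≡-Reasoning
absorption (suc m) zero    = begin
    1 * (suc (suc m) C 1)  ≡⟨ *-identityˡ _ ⟩
    suc (suc m) C 1        ≡⟨ nC1≡n (suc (suc m)) ⟩
    suc (suc m)            ≡⟨ *-identityʳ (suc (suc m)) ⟨
    suc (suc m) * 1        ∎
  where open ≡-Reasoning
absorption (suc m) (suc k) = begin
    suc (suc k) * (suc (suc m) C suc (suc k))
      ≡⟨ cong (suc (suc k) *_) (sym (nCk+nC[k+1]≡[n+1]C[k+1] (suc m) (suc k))) ⟩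
    suc (suc k) * (a + b)
      ≡⟨ split (suc k) a b ⟩
    suc k * a + a + suc (suc k) * b
      ≡⟨ cong₂ (λ x y → x + a + y) (absorption m k) (absorption m (suc k)) ⟩
    suc m * (m C k) + a + suc m * (m C suc k)
      ≡⟨ collect (suc m) (m C k) a (m C suc k) ⟩
    suc m * ((m C k) + (m C suc k)) + a
      ≡⟨ cong (λ x → suc m * x + a) (nCk+nC[k+1]≡[n+1]C[k+1] m k) ⟩
    suc m * a + a
      ≡⟨ +-comm (suc m * a) a ⟩
    suc (suc m) * a ∎
  where
  open ≡-Reasoning
  a = suc m C suc k
  b = suc m C suc (suc k)
  split : ∀ x a b → suc x * (a + b) ≡ x * a + a + suc x * b
  split = solve-∀
  collect : ∀ x p a q → x * p + a + x * q ≡ x * (p + q) + a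
  collect = solve-∀

-- Euclidean step for coprimality: if a·x + r = b·d, or a·x = b·d + r, then
-- every common divisor of d and x divides r, so Coprime d r gives Coprime d x.
coprime-below : ∀ {d x} a r b → a * x + r ≡ b * d → Coprime d r → Coprime d x
coprime-below a r b ax+r≡bd d⊥r {c} (c∣d , c∣x) =
  d⊥r (c∣d , ∣m+n∣m⇒∣n (subst (c ∣_) (sym ax+r≡bd) (∣n⇒∣m*n b c∣d)) (∣n⇒∣m*n a c∣x))

coprime-above : ∀ {d x} a b r → a * x ≡ b * d + r → Coprime d r → Coprime d x
coprime-above a b r ax≡bd+r d⊥r {c} (c∣d , c∣x) =
  d⊥r (c∣d , ∣m+n∣m⇒∣n (subst (c ∣_) ax≡bd+r (∣n⇒∣m*n a c∣x)) (∣n⇒∣m*n b c∣d))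

-- A small number p is prime to d when the residue s of d modulo p is; the
-- latter is a closed fact, decided by computation.
coprime-mod : ∀ {d p} q s → d ≡ q * p + s → Coprime p s → Coprime d p
coprime-mod {d} q s eq p⊥s = Coprimality.sym (coprime-above 1 q s (trans (*-identityˡ d) eq) p⊥s)

coprime-unit : ∀ d → Coprime d 1
coprime-unit d = Coprimality.sym (1-coprimeTo d)

coprime-* : ∀ {d a b} → Coprime d a → Coprime d b → Coprime d (a * b)
coprime-* d⊥a d⊥b (c∣d , c∣ab) =
  d⊥b (c∣d , coprime-divisor (λ (e∣c , e∣a) → d⊥a (∣-trans e∣c c∣d , e∣a)) c∣ab)

coprime-product : ∀ {d e X} → Coprime d e → d ∣ X → e ∣ X → d * e ∣ X
coprime-product {d} {e} {X} d⊥e (divides q X≡qd) e∣X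
  with coprime-divisor (Coprimality.sym d⊥e) (subst (e ∣_) (trans X≡qd (*-comm q d)) e∣X)
... | divides p q≡pe = divides p (begin
    X            ≡⟨ X≡qd ⟩
    q * d        ≡⟨ cong (_* d) q≡pe ⟩
    p * e * d    ≡⟨ *-assoc p e d ⟩
    p * (e * d)  ≡⟨ cong (p *_) (*-comm e d) ⟩
    p * (d * e)  ∎)
  where open ≡-Reasoning

-- First step of a walk: if d ∣ m+1 then d ∣ (k+1)·C(m+1,k+1), and the factor
-- k+1 cancels when it is prime to d.
start : ∀ {d} m k → d ∣ suc m → Coprime d (suc k) → d ∣ suc m C suc k
start {d} m k d∣m+1 d⊥k+1 =
  coprime-divisor d⊥k+1 (subst (d ∣_) (sym (absorption m k)) (∣m⇒∣m*n (m C k) d∣m+1))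

climb : ∀ {d} m k → Coprime d (suc k) → d ∣ m C k → d ∣ suc m C suc k
climb {d} m k d⊥k+1 d∣Y =
  coprime-divisor d⊥k+1 (subst (d ∣_) (sym (absorption m k)) (∣n⇒∣m*n (suc m) d∣Y))

climb-scaled : ∀ {d} c m k → Coprime d (suc k) → d ∣ c * (m C k) → d ∣ c * (suc m C suc k)
climb-scaled {d} c m k d⊥k+1 d∣cY =
  coprime-divisor d⊥k+1 (subst (d ∣_) (sym scaled-absorption) (∣n⇒∣m*n (suc m) d∣cY))
  where
  open ≡-Reasoning
  swap : ∀ x y z → x * (y * z) ≡ y * (x * z)
  swap = solve-∀
  scaled-absorption : suc k * (c * (suc m C suc k)) ≡ suc m * (c * (m C k))
  scaled-absorption = begin
    suc k * (c * (suc m C suc k))  ≡⟨ swap (suc k) c _ ⟩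
    c * (suc k * (suc m C suc k))  ≡⟨ cong (c *_) (absorption m k) ⟩
    c * (suc m * (m C k))          ≡⟨ swap c (suc m) _ ⟩
    suc m * (c * (m C k))          ∎

-- Modulo d, a·x + r = b·d says a·x ≡ −r; hence d ∣ x·Y implies d ∣ r·Y.
reduce : ∀ {d x Y} a r b → a * x + r ≡ b * d → d ∣ x * Y → d ∣ r * Y
reduce {d} {x} {Y} a r b ax+r≡bd d∣xY =
  ∣m+n∣m⇒∣n (subst (d ∣_) expand (∣m⇒∣m*n Y (n∣m*n b))) (∣n⇒∣m*n a d∣xY)
  where
  distrib : ∀ a x r Y → (a * x + r) * Y ≡ a * (x * Y) + r * Y
  distrib = solve-∀
  expand : b * d * Y ≡ a * (x * Y) + r * Y
  expand = trans (cong (_* Y) (sym ax+r≡bd)) (distrib a x r Y)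

-- A step up the diagonal where k+1 need not be prime to d: the factor k+1
-- is replaced by its small residue r, which becomes the new multiplier.
climb-reducing : ∀ {d} m k a r b → a * suc k + r ≡ b * d → d ∣ m C k → d ∣ r * (suc m C suc k)
climb-reducing {d} m k a r b eq d∣Y =
  reduce a r b eq (subst (d ∣_) (sym (absorption m k)) (∣n⇒∣m*n (suc m) d∣Y))

diagonal-ratio : ∀ g a b m k → suc g * a ≡ suc k → suc g * b ≡ suc m →
                 a * (suc m C suc k) ≡ b * (m C k)
diagonal-ratio g a b m k ga≡k+1 gb≡m+1 = *-cancelˡ-≡ _ _ (suc g) (begin
    suc g * (a * (suc m C suc k))  ≡⟨ *-assoc (suc g) a _ ⟨
    suc g * a * (suc m C suc k)    ≡⟨ cong (_* (suc m C suc k)) ga≡k+1 ⟩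
    suc k * (suc m C suc k)        ≡⟨ absorption m k ⟩
    suc m * (m C k)                ≡⟨ cong (_* (m C k)) gb≡m+1 ⟨
    suc g * b * (m C k)            ≡⟨ *-assoc (suc g) b _ ⟩
    suc g * (b * (m C k))          ∎)
  where open ≡-Reasoning

-- Last step of a walk that carries a multiplier c: if the ratio (m+1)/(k+1)
-- equals (e·c)/a with a prime to d, the multiplier is absorbed.
climb-ratio : ∀ {d} g a e c m k → suc g * a ≡ suc k → suc g * (e * c) ≡ suc m →
              Coprime d a → d ∣ c * (m C k) → d ∣ suc m C suc k
climb-ratio {d} g a e c m k ga≡k+1 gec≡m+1 d⊥a d∣cY =
  coprime-divisor d⊥a (subst (d ∣_) ecY≡aX (∣n⇒∣m*n e d∣cY))
  where
  ecY≡aX : e * (c * (m C k)) ≡ a * (suc m C suc k)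
  ecY≡aX = trans (sym (*-assoc e c _)) (sym (diagonal-ratio g a (e * c) m k ga≡k+1 gec≡m+1))

29+30t⊥2 : ∀ t → Coprime (29 + 30 * t) 2
29+30t⊥2 t = coprime-mod (14 + 15 * t) 1 (29 + 30 * t ≡ (14 + 15 * t) * 2 + 1 ∋ solve (t ∷ [])) (coprime-unit 2)

29+30t⊥3 : ∀ t → Coprime (29 + 30 * t) 3
29+30t⊥3 t = coprime-mod (9 + 10 * t) 2 (29 + 30 * t ≡ (9 + 10 * t) * 3 + 2 ∋ solve (t ∷ [])) (from-yes (coprime? 3 2))

29+30t⊥5 : ∀ t → Coprime (29 + 30 * t) 5
29+30t⊥5 t = coprime-mod (5 + 6 * t) 4 (29 + 30 * t ≡ (5 + 6 * t) * 5 + 4 ∋ solve (t ∷ [])) (from-yes (coprime? 5 4))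

-- 6n − 1 ∣ C(12n, 3n): walk up from 12n − 2 = 2(6n − 1); for k + 1 = 3n − 2,
-- 3n − 1, 3n we have 2(k + 1) ≡ −3, −1, 1 modulo 6n − 1.
case₁ : ∀ t → (5 + 6 * t) ∣ (12 + 12 * t) C (3 + 3 * t)
case₁ t = X
  where
  ⊥3 : Coprime (5 + 6 * t) 3
  ⊥3 = coprime-mod (1 + 2 * t) 2 (5 + 6 * t ≡ (1 + 2 * t) * 3 + 2 ∋ solve (t ∷ [])) (from-yes (coprime? 3 2))
  B : (5 + 6 * t) ∣ (10 + 12 * t) C (1 + 3 * t)
  B = start (9 + 12 * t) (3 * t) (divides 2 (10 + 12 * t ≡ 2 * (5 + 6 * t) ∋ solve (t ∷ [])))
        (coprime-below 2 3 1 (2 * (1 + 3 * t) + 3 ≡ 1 * (5 + 6 * t) ∋ solve (t ∷ [])) ⊥3)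
  A : (5 + 6 * t) ∣ (11 + 12 * t) C (2 + 3 * t)
  A = climb (10 + 12 * t) (1 + 3 * t)
        (coprime-below 2 1 1 (2 * (2 + 3 * t) + 1 ≡ 1 * (5 + 6 * t) ∋ solve (t ∷ [])) (coprime-unit _)) B
  X : (5 + 6 * t) ∣ (12 + 12 * t) C (3 + 3 * t)
  X = climb (11 + 12 * t) (2 + 3 * t)
        (coprime-above 2 1 1 (2 * (3 + 3 * t) ≡ 1 * (5 + 6 * t) + 1 ∋ solve (t ∷ [])) (coprime-unit _)) A

-- 6n − 1 ∣ C(12n, 4n): walk up from 12n − 2; for k + 1 = 4n − 2, 4n − 1, 4n
-- we have 3(k + 1) ≡ −4, −1, 2.
case₂ : ∀ t → (5 + 6 * t) ∣ (12 + 12 * t) C (4 + 4 * t)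
case₂ t = X
  where
  ⊥2 : Coprime (5 + 6 * t) 2
  ⊥2 = coprime-mod (2 + 3 * t) 1 (5 + 6 * t ≡ (2 + 3 * t) * 2 + 1 ∋ solve (t ∷ [])) (coprime-unit 2)
  B : (5 + 6 * t) ∣ (10 + 12 * t) C (2 + 4 * t)
  B = start (9 + 12 * t) (1 + 4 * t) (divides 2 (10 + 12 * t ≡ 2 * (5 + 6 * t) ∋ solve (t ∷ [])))
        (coprime-below 3 4 2 (3 * (2 + 4 * t) + 4 ≡ 2 * (5 + 6 * t) ∋ solve (t ∷ [])) (coprime-* ⊥2 ⊥2))
  A : (5 + 6 * t) ∣ (11 + 12 * t) C (3 + 4 * t)
  A = climb (10 + 12 * t) (2 + 4 * t)
        (coprime-below 3 1 2 (3 * (3 + 4 * t) + 1 ≡ 2 * (5 + 6 * t) ∋ solve (t ∷ [])) (coprime-unit _)) B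
  X : (5 + 6 * t) ∣ (12 + 12 * t) C (4 + 4 * t)
  X = climb (11 + 12 * t) (3 + 4 * t)
        (coprime-above 3 2 2 (3 * (4 + 4 * t) ≡ 2 * (5 + 6 * t) + 2 ∋ solve (t ∷ [])) ⊥2) A

-- (10n − 1)(15n − 1) ∣ C(30n, 5n): the factors are coprime, since
-- 2(15n − 1) = 3(10n − 1) + 1.  For 10n − 1 walk up from 30n − 3; at
-- k + 1 = 5n − 2 only 2(k + 1) ≡ −3 is known, so a multiplier 3 is carried
-- and removed by C(30n, 5n) = 6·C(30n − 1, 5n − 1).  For 15n − 1 walk up
-- from 30n − 2; at k + 1 = 5n − 1, 3(k + 1) ≡ −2 leaves a multiplier 2.
case₃ : ∀ t → ((9 + 10 * t) * (14 + 15 * t)) ∣ (30 + 30 * t) C (5 + 5 * t)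
case₃ t = coprime-product d₁⊥d₂ X₁ X₂
  where
  d₁⊥d₂ : Coprime (9 + 10 * t) (14 + 15 * t)
  d₁⊥d₂ = coprime-above 2 3 1 (2 * (14 + 15 * t) ≡ 3 * (9 + 10 * t) + 1 ∋ solve (t ∷ [])) (coprime-unit _)
  k+1 : (5 + 5 * t) * 1 ≡ 5 + 5 * t
  k+1 = solve (t ∷ [])
  m+1 : (5 + 5 * t) * 6 ≡ 30 + 30 * t
  m+1 = solve (t ∷ [])
  B₁ : (9 + 10 * t) ∣ (27 + 30 * t) C (2 + 5 * t)
  B₁ = start (26 + 30 * t) (1 + 5 * t) (divides 3 (27 + 30 * t ≡ 3 * (9 + 10 * t) ∋ solve (t ∷ [])))
         (coprime-below 2 5 1 (2 * (2 + 5 * t) + 5 ≡ 1 * (9 + 10 * t) ∋ solve (t ∷ []))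
           (coprime-mod (1 + 2 * t) 4 (9 + 10 * t ≡ (1 + 2 * t) * 5 + 4 ∋ solve (t ∷ [])) (from-yes (coprime? 5 4))))
  A₁ : (9 + 10 * t) ∣ 3 * ((28 + 30 * t) C (3 + 5 * t))
  A₁ = climb-reducing (27 + 30 * t) (2 + 5 * t) 2 3 1 (2 * (3 + 5 * t) + 3 ≡ 1 * (9 + 10 * t) ∋ solve (t ∷ [])) B₁
  Y₁ : (9 + 10 * t) ∣ 3 * ((29 + 30 * t) C (4 + 5 * t))
  Y₁ = climb-scaled 3 (28 + 30 * t) (3 + 5 * t)
         (coprime-below 2 1 1 (2 * (4 + 5 * t) + 1 ≡ 1 * (9 + 10 * t) ∋ solve (t ∷ [])) (coprime-unit _)) A₁
  X₁ : (9 + 10 * t) ∣ (30 + 30 * t) C (5 + 5 * t)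
  X₁ = climb-ratio (4 + 5 * t) 1 2 3 (29 + 30 * t) (4 + 5 * t) k+1 m+1 (coprime-unit _) Y₁
  A₂ : (14 + 15 * t) ∣ (28 + 30 * t) C (3 + 5 * t)
  A₂ = start (27 + 30 * t) (2 + 5 * t) (divides 2 (28 + 30 * t ≡ 2 * (14 + 15 * t) ∋ solve (t ∷ [])))
         (coprime-below 3 5 1 (3 * (3 + 5 * t) + 5 ≡ 1 * (14 + 15 * t) ∋ solve (t ∷ []))
           (coprime-mod (2 + 3 * t) 4 (14 + 15 * t ≡ (2 + 3 * t) * 5 + 4 ∋ solve (t ∷ [])) (from-yes (coprime? 5 4))))
  Y₂ : (14 + 15 * t) ∣ 2 * ((29 + 30 * t) C (4 + 5 * t))
  Y₂ = climb-reducing (28 + 30 * t) (3 + 5 * t) 3 2 1 (3 * (4 + 5 * t) + 2 ≡ 1 * (14 + 15 * t) ∋ solve (t ∷ [])) A₂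
  X₂ : (14 + 15 * t) ∣ (30 + 30 * t) C (5 + 5 * t)
  X₂ = climb-ratio (4 + 5 * t) 1 3 2 (29 + 30 * t) (4 + 5 * t) k+1 m+1 (coprime-unit _) Y₂

-- 30n − 1 ∣ C(60n, 6n): walk up from 60n − 2; 5(k + 1) ≡ −9, −4, 1.
case₄ : ∀ t → (29 + 30 * t) ∣ (60 + 60 * t) C (6 + 6 * t)
case₄ t = X
  where
  B : (29 + 30 * t) ∣ (58 + 60 * t) C (4 + 6 * t)
  B = start (57 + 60 * t) (3 + 6 * t) (divides 2 (58 + 60 * t ≡ 2 * (29 + 30 * t) ∋ solve (t ∷ [])))
        (coprime-below 5 9 1 (5 * (4 + 6 * t) + 9 ≡ 1 * (29 + 30 * t) ∋ solve (t ∷ []))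
          (coprime-* (29+30t⊥3 t) (29+30t⊥3 t)))
  A : (29 + 30 * t) ∣ (59 + 60 * t) C (5 + 6 * t)
  A = climb (58 + 60 * t) (4 + 6 * t)
        (coprime-below 5 4 1 (5 * (5 + 6 * t) + 4 ≡ 1 * (29 + 30 * t) ∋ solve (t ∷ []))
          (coprime-* (29+30t⊥2 t) (29+30t⊥2 t))) B
  X : (29 + 30 * t) ∣ (60 + 60 * t) C (6 + 6 * t)
  X = climb (59 + 60 * t) (5 + 6 * t)
        (coprime-above 5 1 1 (5 * (6 + 6 * t) ≡ 1 * (29 + 30 * t) + 1 ∋ solve (t ∷ [])) (coprime-unit _)) A

-- 30n − 1 ∣ C(120n, 40n): walk up from 120n − 4 = 4(30n − 1);
-- 3(k + 1) ≡ −8, −5, −2, 1, 4 for k + 1 = 40n − 4, …, 40n.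
case₅ : ∀ t → (29 + 30 * t) ∣ (120 + 120 * t) C (40 + 40 * t)
case₅ t = X
  where
  ⊥4 : Coprime (29 + 30 * t) 4
  ⊥4 = coprime-* (29+30t⊥2 t) (29+30t⊥2 t)
  A₄ : (29 + 30 * t) ∣ (116 + 120 * t) C (36 + 40 * t)
  A₄ = start (115 + 120 * t) (35 + 40 * t) (divides 4 (116 + 120 * t ≡ 4 * (29 + 30 * t) ∋ solve (t ∷ [])))
         (coprime-below 3 8 4 (3 * (36 + 40 * t) + 8 ≡ 4 * (29 + 30 * t) ∋ solve (t ∷ []))
           (coprime-* (29+30t⊥2 t) ⊥4))
  A₃ : (29 + 30 * t) ∣ (117 + 120 * t) C (37 + 40 * t)
  A₃ = climb (116 + 120 * t) (36 + 40 * t)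
         (coprime-below 3 5 4 (3 * (37 + 40 * t) + 5 ≡ 4 * (29 + 30 * t) ∋ solve (t ∷ [])) (29+30t⊥5 t)) A₄
  A₂ : (29 + 30 * t) ∣ (118 + 120 * t) C (38 + 40 * t)
  A₂ = climb (117 + 120 * t) (37 + 40 * t)
         (coprime-below 3 2 4 (3 * (38 + 40 * t) + 2 ≡ 4 * (29 + 30 * t) ∋ solve (t ∷ [])) (29+30t⊥2 t)) A₃
  A₁ : (29 + 30 * t) ∣ (119 + 120 * t) C (39 + 40 * t)
  A₁ = climb (118 + 120 * t) (38 + 40 * t)
         (coprime-above 3 4 1 (3 * (39 + 40 * t) ≡ 4 * (29 + 30 * t) + 1 ∋ solve (t ∷ [])) (coprime-unit _)) A₂
  X : (29 + 30 * t) ∣ (120 + 120 * t) C (40 + 40 * t)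
  X = climb (119 + 120 * t) (39 + 40 * t)
        (coprime-above 3 4 4 (3 * (40 + 40 * t) ≡ 4 * (29 + 30 * t) + 4 ∋ solve (t ∷ [])) ⊥4) A₁

-- 30n − 1 ∣ C(120n, 45n): walk up from 120n − 4; 2(k + 1) ≡ −5, −3, −1, 1, 3
-- for k + 1 = 45n − 4, …, 45n.
case₆ : ∀ t → (29 + 30 * t) ∣ (120 + 120 * t) C (45 + 45 * t)
case₆ t = X
  where
  A₄ : (29 + 30 * t) ∣ (116 + 120 * t) C (41 + 45 * t)
  A₄ = start (115 + 120 * t) (40 + 45 * t) (divides 4 (116 + 120 * t ≡ 4 * (29 + 30 * t) ∋ solve (t ∷ [])))
         (coprime-below 2 5 3 (2 * (41 + 45 * t) + 5 ≡ 3 * (29 + 30 * t) ∋ solve (t ∷ [])) (29+30t⊥5 t))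
  A₃ : (29 + 30 * t) ∣ (117 + 120 * t) C (42 + 45 * t)
  A₃ = climb (116 + 120 * t) (41 + 45 * t)
         (coprime-below 2 3 3 (2 * (42 + 45 * t) + 3 ≡ 3 * (29 + 30 * t) ∋ solve (t ∷ [])) (29+30t⊥3 t)) A₄
  A₂ : (29 + 30 * t) ∣ (118 + 120 * t) C (43 + 45 * t)
  A₂ = climb (117 + 120 * t) (42 + 45 * t)
         (coprime-below 2 1 3 (2 * (43 + 45 * t) + 1 ≡ 3 * (29 + 30 * t) ∋ solve (t ∷ [])) (coprime-unit _)) A₃
  A₁ : (29 + 30 * t) ∣ (119 + 120 * t) C (44 + 45 * t)
  A₁ = climb (118 + 120 * t) (43 + 45 * t)
         (coprime-above 2 3 1 (2 * (44 + 45 * t) ≡ 3 * (29 + 30 * t) + 1 ∋ solve (t ∷ [])) (coprime-unit _)) A₂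
  X : (29 + 30 * t) ∣ (120 + 120 * t) C (45 + 45 * t)
  X = climb (119 + 120 * t) (44 + 45 * t)
        (coprime-above 2 3 3 (2 * (45 + 45 * t) ≡ 3 * (29 + 30 * t) + 3 ∋ solve (t ∷ [])) (29+30t⊥3 t)) A₁

-- 66n − 1 ∣ C(330n, 88n): walk up from 330n − 5 = 5(66n − 1);
-- 3(k + 1) ≡ −11, −8, −5, −2, 1 for k + 1 = 88n − 5, …, 88n − 1.  The residue
-- −5 is carried as a multiplier and absorbed by
-- 4·C(330n, 88n) = 15·C(330n − 1, 88n − 1), 4 being prime to 66n − 1.
case₇ : ∀ t → (65 + 66 * t) ∣ (330 + 330 * t) C (88 + 88 * t)
case₇ t = X
  where
  ⊥2 : Coprime (65 + 66 * t) 2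
  ⊥2 = coprime-mod (32 + 33 * t) 1 (65 + 66 * t ≡ (32 + 33 * t) * 2 + 1 ∋ solve (t ∷ [])) (coprime-unit 2)
  ⊥4 : Coprime (65 + 66 * t) 4
  ⊥4 = coprime-* ⊥2 ⊥2
  B₄ : (65 + 66 * t) ∣ (325 + 330 * t) C (83 + 88 * t)
  B₄ = start (324 + 330 * t) (82 + 88 * t) (divides 5 (325 + 330 * t ≡ 5 * (65 + 66 * t) ∋ solve (t ∷ [])))
         (coprime-below 3 11 4 (3 * (83 + 88 * t) + 11 ≡ 4 * (65 + 66 * t) ∋ solve (t ∷ []))
           (coprime-mod (5 + 6 * t) 10 (65 + 66 * t ≡ (5 + 6 * t) * 11 + 10 ∋ solve (t ∷ [])) (from-yes (coprime? 11 10))))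
  B₃ : (65 + 66 * t) ∣ (326 + 330 * t) C (84 + 88 * t)
  B₃ = climb (325 + 330 * t) (83 + 88 * t)
         (coprime-below 3 8 4 (3 * (84 + 88 * t) + 8 ≡ 4 * (65 + 66 * t) ∋ solve (t ∷ [])) (coprime-* ⊥2 ⊥4)) B₄
  B₂ : (65 + 66 * t) ∣ 5 * ((327 + 330 * t) C (85 + 88 * t))
  B₂ = climb-reducing (326 + 330 * t) (84 + 88 * t) 3 5 4 (3 * (85 + 88 * t) + 5 ≡ 4 * (65 + 66 * t) ∋ solve (t ∷ [])) B₃
  B₁ : (65 + 66 * t) ∣ 5 * ((328 + 330 * t) C (86 + 88 * t))
  B₁ = climb-scaled 5 (327 + 330 * t) (85 + 88 * t)
         (coprime-below 3 2 4 (3 * (86 + 88 * t) + 2 ≡ 4 * (65 + 66 * t) ∋ solve (t ∷ [])) ⊥2) B₂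
  Y : (65 + 66 * t) ∣ 5 * ((329 + 330 * t) C (87 + 88 * t))
  Y = climb-scaled 5 (328 + 330 * t) (86 + 88 * t)
        (coprime-above 3 4 1 (3 * (87 + 88 * t) ≡ 4 * (65 + 66 * t) + 1 ∋ solve (t ∷ [])) (coprime-unit _)) B₁
  X : (65 + 66 * t) ∣ (330 + 330 * t) C (88 + 88 * t)
  X = climb-ratio (21 + 22 * t) 4 3 5 (329 + 330 * t) (87 + 88 * t)
        ((22 + 22 * t) * 4 ≡ 88 + 88 * t ∋ solve (t ∷ [])) ((22 + 22 * t) * 15 ≡ 330 + 330 * t ∋ solve (t ∷ [])) ⊥4 Y

theorem2p3 : (n : ℕ) → n ≥ 1 →
      ((6 * n ∸ 1) ∣ ((12 * n) C (3 * n)))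
    × ((6 * n ∸ 1) ∣ ((12 * n) C (4 * n)))
    × (((10 * n ∸ 1) * (15 * n ∸ 1)) ∣ ((30 * n) C (5 * n)))
    × ((30 * n ∸ 1) ∣ ((60 * n) C (6 * n)))
    × ((30 * n ∸ 1) ∣ ((120 * n) C (40 * n)))
    × ((30 * n ∸ 1) ∣ ((120 * n) C (45 * n)))
    × ((66 * n ∸ 1) ∣ ((330 * n) C (88 * n)))
theorem2p3 (suc t) (s≤s z≤n) =
    subst₂ _∣_ (modulus 6) (binomial 12 3) (case₁ t)
  , subst₂ _∣_ (modulus 6) (binomial 12 4) (case₂ t)
  , subst₂ _∣_ (cong₂ _*_ (modulus 10) (modulus 15)) (binomial 30 5) (case₃ t)
  , subst₂ _∣_ (modulus 30) (binomial 60 6) (case₄ t)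
  , subst₂ _∣_ (modulus 30) (binomial 120 40) (case₅ t)
  , subst₂ _∣_ (modulus 30) (binomial 120 45) (case₆ t)
  , subst₂ _∣_ (modulus 66) (binomial 330 88) (case₇ t)
  where
  modulus : ∀ a → a + a * t ∸ 1 ≡ a * suc t ∸ 1
  modulus a = cong (_∸ 1) (sym (*-suc a t))
  binomial : ∀ b c → (b + b * t) C (c + c * t) ≡ (b * suc t) C (c * suc t)
  binomial b c = sym (cong₂ _C_ (*-suc b t) (*-suc c t))
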